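{- Let $G_1,G_2$ be $q$-cut-dense graphs. Then $G_1\cup G_2$ is $\dfrac{q\,|V(G_1)\cap V(G_2)|}{4\,|V(G_1)\cup V(G_2)|}$-cut-dense.
   Context: $G_1\cup G_2$ is the graph with vertex set $V(G_1)\cup V(G_2)$ and edge set $E(G_1)\cup E(G_2)$. A graph $F$ is $q$-cut-dense if for every partition $V(F)=A\cup B$ we have $e_F(A,B)\ge q|A||B|$, where $e_F(A,B)$ is the number of edges of $F$ with one endpoint in $A$ and the other in $B$. -}

module Defs where

open import Data.Bool using (Bool; true; false; _∨_; _∧_; if_then_else_)
open import Data.Nat using (ℕ; NonZero; _*_)
open import Data.Nat.Properties using (m*n≢0)
open import Data.Fin using (Fin)
open import Data.Fin.Subset using (Subset; _∈_; _∪_; _∩_; ∣_∣; ⊥)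
open import Data.Fin.Subset.Properties using (x∈p∪q⁺)
open import Data.Vec using (lookup)
open import Data.List using (map; allFin)
open import Data.Nat.ListAction using (sum)
open import Data.Integer using (+_)
open import Data.Rational using (ℚ; _/_) renaming (_≤_ to _≤ℚ_; _*_ to _*ℚ_)
open import Data.Product using (_×_; _,_)
open import Data.Sum using (inj₁; inj₂)
open import Relation.Binary.PropositionalEquality using (_≡_; refl; cong₂)

record Graph (n : ℕ) : Set where
  field
    V      : Subset n
    E      : Fin n → Fin n → Bool
    E-sym  : ∀ u v → E u v ≡ E v u
    E-irr  : ∀ v → E v v ≡ false
    E-in-V : ∀ u v → E u v ≡ true → (u ∈ V) × (v ∈ V)

open Graph public

_∪ᴳ_ : ∀ {n} → Graph n → Graph n → Graph n
V (G₁ ∪ᴳ G₂) = V G₁ ∪ V G₂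
E (G₁ ∪ᴳ G₂) u v = E G₁ u v ∨ E G₂ u v
E-sym (G₁ ∪ᴳ G₂) u v = cong₂ _∨_ (E-sym G₁ u v) (E-sym G₂ u v)
E-irr (G₁ ∪ᴳ G₂) v rewrite E-irr G₁ v | E-irr G₂ v = refl
E-in-V (G₁ ∪ᴳ G₂) u v h with E G₁ u v in eq₁
... | true  with E-in-V G₁ u v eq₁
...   | (a , b) = x∈p∪q⁺ (inj₁ a) , x∈p∪q⁺ (inj₁ b)
E-in-V (G₁ ∪ᴳ G₂) u v h | false with E-in-V G₂ u v h
...   | (a , b) = x∈p∪q⁺ (inj₂ a) , x∈p∪q⁺ (inj₂ b)

-- e_F(A,B): number of pairs (a , b) with a ∈ A, b ∈ B and ab an edge of F.
-- (For disjoint A, B this is exactly the number of edges between A and B.)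
eCount : ∀ {n} → Graph n → Subset n → Subset n → ℕ
eCount {n} F A B =
  sum (map (λ a → sum (map (λ b →
        if lookup A a ∧ lookup B b ∧ E F a b then 1 else 0)
      (allFin n))) (allFin n))

ℕ→ℚ : ℕ → ℚ
ℕ→ℚ k = (+ k) / 1

CutDense : ∀ {n} → ℚ → Graph n → Set
CutDense q F = ∀ A B → A ∩ B ≡ ⊥ → A ∪ B ≡ V F →
  (q *ℚ ℕ→ℚ (∣ A ∣ * ∣ B ∣)) ≤ℚ ℕ→ℚ (eCount F A B)

quarterRatio : (a d : ℕ) → .{{NonZero d}} → ℚ
quarterRatio a d = _/_ (+ a) (4 * d) {{m*n≢0 4 d}}

-- Restricting a cut (A, B) of V₁ ∪ V₂ to Vₖ gives a cut of Gₖ, so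
-- e(A, B) ≥ q |A ∩ Vₖ| |B ∩ Vₖ| for k = 1, 2.  Every vertex of I = V₁ ∩ V₂ lies in
-- both Vₖ, so |A ∩ I| |B| and |B ∩ I| |A| are each at most
-- |A ∩ V₁| |B ∩ V₁| + |A ∩ V₂| |B ∩ V₂| ≤ 2 maxₖ |A ∩ Vₖ| |B ∩ Vₖ|.  As |I| ≤ |A ∩ I| + |B ∩ I|
-- and |A|, |B| ≤ |V₁ ∪ V₂|, this yields |I| |A| |B| ≤ 4 |V₁ ∪ V₂| maxₖ |A ∩ Vₖ| |B ∩ Vₖ|.
-- For q < 0 the claim is trivial.

module Submission where

open import Defs
open import Data.Bool using (true; false; _∧_; if_then_else_)
open import Data.Bool.Properties using (∨-zeroʳ)
open import Data.Nat as ℕ using (ℕ; suc; NonZero; _+_; _*_; _≤_; _⊔_; z≤n; s≤s)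
open import Data.Nat.Properties as ℕ
  using (≤-refl; ≤-trans; +-mono-≤; +-suc; *-comm; *-monoʳ-≤; *-monoˡ-≤; *-mono-≤; ⊔-sel; m≤m⊔n; m≤n⊔m; m*n≢0)
open import Data.Nat.Tactic.RingSolver using (solve-∀)
open import Data.Fin.Subset using (Subset; _⊆_; _∈_; _∪_; _∩_; ∣_∣; ⊥)
open import Data.Fin.Subset.Properties
  using (∣p∣≤∣x∷p∣; p⊆q⇒∣p∣≤∣q∣; p⊆p∪q; q⊆p∪q; ⊆-trans; ⊆-antisym; ⊥⊆; p∩q⊆p; p∩q⊆q; x∈p∩q⁺; x∈p∩q⁻; x∈p∪q⁺; x∈p∪q⁻; ∩-comm)
open import Data.Vec using ([]; _∷_; lookup)
open import Data.Vec.Properties using ([]=⇒lookup; lookup⇒[]=)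
open import Data.List using (List; []; _∷_; map; allFin)
open import Data.Nat.ListAction using (sum)
open import Data.Integer as ℤ using (+_)
import Data.Integer.Properties as ℤ
open import Data.Rational as ℚ using (ℚ; 0ℚ; toℚᵘ)
open import Data.Rational.Properties as ℚ
  using (toℚᵘ-cancel-≤; toℚᵘ-homo-*; toℚᵘ-fromℚᵘ; *-assoc; *-zeroʳ; *-monoˡ-≤-nonNeg; *-monoˡ-≤-nonPos)
open import Data.Rational.Unnormalised as ℚᵘ using (mkℚᵘ; *≤*)
import Data.Rational.Unnormalised.Properties as ℚᵘ
open import Data.Product using (_,_)
open import Data.Sum using (inj₁; inj₂)
open import Function using (case_of_; id)
open import Relation.Nullary using (yes; no)
open import Relation.Binary.PropositionalEquality using (_≡_; refl; sym; trans; cong; cong₂; subst)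

private
  variable
    n : ℕ

∣p∪q∣≤∣p∣+∣q∣ : (p q : Subset n) → ∣ p ∪ q ∣ ≤ ∣ p ∣ + ∣ q ∣
∣p∪q∣≤∣p∣+∣q∣ []          []          = z≤n
∣p∪q∣≤∣p∣+∣q∣ (true ∷ p)  (y ∷ q)     = s≤s (≤-trans (∣p∪q∣≤∣p∣+∣q∣ p q) (+-mono-≤ ≤-refl (∣p∣≤∣x∷p∣ y q)))
∣p∪q∣≤∣p∣+∣q∣ (false ∷ p) (true ∷ q)  rewrite +-suc ∣ p ∣ ∣ q ∣ = s≤s (∣p∪q∣≤∣p∣+∣q∣ p q)
∣p∪q∣≤∣p∣+∣q∣ (false ∷ p) (false ∷ q) = ∣p∪q∣≤∣p∣+∣q∣ p q

restrict-disjoint : {A B : Subset n} (W : Subset n) → A ∩ B ≡ ⊥ → (A ∩ W) ∩ (B ∩ W) ≡ ⊥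
restrict-disjoint {A = A} {B} W A∩B≡⊥ = ⊆-antisym into-A∩B ⊥⊆
  where
  into-A∩B : (A ∩ W) ∩ (B ∩ W) ⊆ ⊥
  into-A∩B x∈ with x∈p∩q⁻ (A ∩ W) (B ∩ W) x∈
  ... | x∈A∩W , x∈B∩W = subst (_ ∈_) A∩B≡⊥ (x∈p∩q⁺ (p∩q⊆p A W x∈A∩W , p∩q⊆p B W x∈B∩W))

restrict-cover : {A B W : Subset n} → W ⊆ A ∪ B → (A ∩ W) ∪ (B ∩ W) ≡ W
restrict-cover {A = A} {B} {W} W⊆A∪B = ⊆-antisym into-W onto-W
  where
  into-W : (A ∩ W) ∪ (B ∩ W) ⊆ W
  into-W x∈ with x∈p∪q⁻ (A ∩ W) (B ∩ W) x∈
  ... | inj₁ x∈A∩W = p∩q⊆q A W x∈A∩W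
  ... | inj₂ x∈B∩W = p∩q⊆q B W x∈B∩W
  onto-W : W ⊆ (A ∩ W) ∪ (B ∩ W)
  onto-W x∈W with x∈p∪q⁻ A B (W⊆A∪B x∈W)
  ... | inj₁ x∈A = x∈p∪q⁺ (inj₁ (x∈p∩q⁺ (x∈A , x∈W)))
  ... | inj₂ x∈B = x∈p∪q⁺ (inj₂ (x∈p∩q⁺ (x∈B , x∈W)))

∣r∣≤∣p∩r∣+∣q∩r∣ : {p q r : Subset n} → r ⊆ p ∪ q → ∣ r ∣ ≤ ∣ p ∩ r ∣ + ∣ q ∩ r ∣
∣r∣≤∣p∩r∣+∣q∩r∣ {p = p} {q} {r} r⊆p∪q =
  subst (λ X → ∣ X ∣ ≤ ∣ p ∩ r ∣ + ∣ q ∩ r ∣) (restrict-cover r⊆p∪q) (∣p∪q∣≤∣p∣+∣q∣ (p ∩ r) (q ∩ r))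

∣p∣≤∣p∩q∣+∣p∩r∣ : {p q r : Subset n} → p ⊆ q ∪ r → ∣ p ∣ ≤ ∣ p ∩ q ∣ + ∣ p ∩ r ∣
∣p∣≤∣p∩q∣+∣p∩r∣ {p = p} {q} {r} p⊆q∪r
  rewrite ∩-comm p q | ∩-comm p r = ∣r∣≤∣p∩r∣+∣q∩r∣ p⊆q∪r

∣p∩q∣≤∣p∩r∣ : (p : Subset n) {q r : Subset n} → q ⊆ r → ∣ p ∩ q ∣ ≤ ∣ p ∩ r ∣
∣p∩q∣≤∣p∩r∣ p {q} q⊆r = p⊆q⇒∣p∣≤∣q∣ λ x∈p∩q → case x∈p∩q⁻ p q x∈p∩q of λ where
  (x∈p , x∈q) → x∈p∩q⁺ (x∈p , q⊆r x∈q)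

record _⊆ᴱ_ (F G : Graph n) : Set where
  field
    edge-mono : ∀ u v → E F u v ≡ true → E G u v ≡ true

open _⊆ᴱ_

⊆ᴱ-∪ᴳˡ : (G₁ G₂ : Graph n) → G₁ ⊆ᴱ (G₁ ∪ᴳ G₂)
edge-mono (⊆ᴱ-∪ᴳˡ G₁ G₂) u v eq rewrite eq = refl

⊆ᴱ-∪ᴳʳ : (G₁ G₂ : Graph n) → G₂ ⊆ᴱ (G₁ ∪ᴳ G₂)
edge-mono (⊆ᴱ-∪ᴳʳ G₁ G₂) u v eq rewrite eq = ∨-zeroʳ (E G₁ u v)

∧-mono-true : ∀ {x x′ y y′} → (x ≡ true → x′ ≡ true) → (y ≡ true → y′ ≡ true) →
  x ∧ y ≡ true → x′ ∧ y′ ≡ true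
∧-mono-true {true}  {y = true}  x⇒x′ y⇒y′ _ rewrite x⇒x′ refl | y⇒y′ refl = refl
∧-mono-true {true}  {y = false} _    _    ()
∧-mono-true {false}             _    _    ()

indicator-mono : ∀ {b b′} → (b ≡ true → b′ ≡ true) → (if b then 1 else 0) ≤ (if b′ then 1 else 0)
indicator-mono {true}  b⇒b′ rewrite b⇒b′ refl = ≤-refl
indicator-mono {false} _    = z≤n

sum-map-mono : ∀ {X : Set} (xs : List X) {f g : X → ℕ} → (∀ x → f x ≤ g x) →
  sum (map f xs) ≤ sum (map g xs)
sum-map-mono []       f≤g = z≤n
sum-map-mono (x ∷ xs) f≤g = +-mono-≤ (f≤g x) (sum-map-mono xs f≤g)

⊆⇒lookup-true : {p q : Subset n} → p ⊆ q → ∀ x → lookup p x ≡ true → lookup q x ≡ true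
⊆⇒lookup-true {p = p} p⊆q x x∈p = []=⇒lookup (p⊆q (lookup⇒[]= x p x∈p))

eCount-mono : {F G : Graph n} {A B A′ B′ : Subset n} → A ⊆ A′ → B ⊆ B′ → F ⊆ᴱ G →
  eCount F A B ≤ eCount G A′ B′
eCount-mono {n} A⊆A′ B⊆B′ F⊆G =
  sum-map-mono (allFin n) λ a → sum-map-mono (allFin n) λ b →
    indicator-mono (∧-mono-true (⊆⇒lookup-true A⊆A′ a) (∧-mono-true (⊆⇒lookup-true B⊆B′ b) (edge-mono F⊆G a b)))

toℚᵘ-ℕ/suc : ∀ i d → toℚᵘ (+ i ℚ./ suc d) ℚᵘ.≃ mkℚᵘ (+ i) d
toℚᵘ-ℕ/suc i d = toℚᵘ-fromℚᵘ (mkℚᵘ (+ i) d)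

ℕ→ℚ-mono-≤ : ∀ {m k} → m ≤ k → ℕ→ℚ m ℚ.≤ ℕ→ℚ k
ℕ→ℚ-mono-≤ {m} {k} m≤k = toℚᵘ-cancel-≤ (begin
  toℚᵘ (ℕ→ℚ m)  ≃⟨ toℚᵘ-ℕ/suc m 0 ⟩
  mkℚᵘ (+ m) 0  ≤⟨ *≤* (ℤ.*-monoʳ-≤-nonNeg (+ 1) (ℤ.+≤+ m≤k)) ⟩
  mkℚᵘ (+ k) 0  ≃⟨ toℚᵘ-ℕ/suc k 0 ⟨
  toℚᵘ (ℕ→ℚ k)  ∎)
  where open ℚᵘ.≤-Reasoning

-- The unfolded *≤* condition for (i / (d + 1)) · (c / 1) ≤ M / 1 in ℚᵘ.
cross-multiply-ℕ : ∀ i d c M → i * c ≤ suc d * M →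
  (+ i ℤ.* + c) ℤ.* + 1 ℤ.≤ + M ℤ.* + (suc d * 1)
cross-multiply-ℕ i d c M ic≤dM = begin
  (+ i ℤ.* + c) ℤ.* + 1  ≡⟨ ℤ.*-identityʳ (+ i ℤ.* + c) ⟩
  + i ℤ.* + c            ≡⟨ ℤ.pos-* i c ⟨
  + (i * c)              ≤⟨ ℤ.+≤+ ic≤dM ⟩
  + (suc d * M)          ≡⟨ cong +_ (trans (*-comm (suc d) M) (cong (M *_) (sym (ℕ.*-identityʳ (suc d))))) ⟩
  + (M * (suc d * 1))    ≡⟨ ℤ.pos-* M (suc d * 1) ⟩
  + M ℤ.* + (suc d * 1)  ∎
  where open ℤ.≤-Reasoning

ℕ/ℕ*ℕ≤ℕ : ∀ i d c M .{{_ : NonZero d}} → i * c ≤ d * M → (+ i ℚ./ d) ℚ.* ℕ→ℚ c ℚ.≤ ℕ→ℚ M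
ℕ/ℕ*ℕ≤ℕ i (suc d) c M ic≤dM = toℚᵘ-cancel-≤ (begin
  toℚᵘ ((+ i ℚ./ suc d) ℚ.* ℕ→ℚ c)          ≃⟨ toℚᵘ-homo-* (+ i ℚ./ suc d) (ℕ→ℚ c) ⟩
  toℚᵘ (+ i ℚ./ suc d) ℚᵘ.* toℚᵘ (ℕ→ℚ c)   ≃⟨ ℚᵘ.*-cong (toℚᵘ-ℕ/suc i d) (toℚᵘ-ℕ/suc c 0) ⟩
  mkℚᵘ (+ i) d ℚᵘ.* mkℚᵘ (+ c) 0            ≤⟨ *≤* (cross-multiply-ℕ i d c M ic≤dM) ⟩
  mkℚᵘ (+ M) 0                               ≃⟨ toℚᵘ-ℕ/suc M 0 ⟨
  toℚᵘ (ℕ→ℚ M)                               ∎)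
  where open ℚᵘ.≤-Reasoning

ℕ/ℕ*ℕ-nonNeg : ∀ i d c .{{_ : NonZero d}} → 0ℚ ℚ.≤ (+ i ℚ./ d) ℚ.* ℕ→ℚ c
ℕ/ℕ*ℕ-nonNeg i d c = ℚ.nonNegative⁻¹ _
  {{ℚ.nonNeg*nonNeg⇒nonNeg (+ i ℚ./ d) {{ℚ.normalize-nonNeg i d}} (ℕ→ℚ c) {{ℚ.normalize-nonNeg c 1}}}}

*-≤-ℕ→ℚ-weakenʳ : ∀ q {x y} e → 0ℚ ℚ.≤ x → x ℚ.≤ y → q ℚ.* y ℚ.≤ ℕ→ℚ e → q ℚ.* x ℚ.≤ ℕ→ℚ e
*-≤-ℕ→ℚ-weakenʳ q {x} e 0≤x x≤y qy≤e with 0ℚ ℚ.≤? q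
... | yes 0≤q = ℚ.≤-trans (*-monoˡ-≤-nonNeg q {{ℚ.nonNegative 0≤q}} x≤y) qy≤e
... | no  0≰q = ℚ.≤-trans qx≤0 (ℕ→ℚ-mono-≤ {0} {e} z≤n)
  where
  qx≤0 : q ℚ.* x ℚ.≤ 0ℚ
  qx≤0 = subst (q ℚ.* x ℚ.≤_) (*-zeroʳ q)
    (*-monoˡ-≤-nonPos q {{ℚ.nonPositive (ℚ.<⇒≤ (ℚ.≰⇒> 0≰q))}} 0≤x)

*-ℕ→ℚ-⊔-≤ : ∀ q m₁ m₂ e → q ℚ.* ℕ→ℚ m₁ ℚ.≤ ℕ→ℚ e → q ℚ.* ℕ→ℚ m₂ ℚ.≤ ℕ→ℚ e →
  q ℚ.* ℕ→ℚ (m₁ ⊔ m₂) ℚ.≤ ℕ→ℚ e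
*-ℕ→ℚ-⊔-≤ q m₁ m₂ e qm₁≤e qm₂≤e with ⊔-sel m₁ m₂
... | inj₁ m₁⊔m₂≡m₁ rewrite m₁⊔m₂≡m₁ = qm₁≤e
... | inj₂ m₁⊔m₂≡m₂ rewrite m₁⊔m₂≡m₂ = qm₂≤e

*-≤-split : ∀ {x y₁ y₂ z z₁ z₂} → x ≤ y₁ → x ≤ y₂ → z ≤ z₁ + z₂ → x * z ≤ y₁ * z₁ + y₂ * z₂
*-≤-split {x} {y₁} {y₂} {z} {z₁} {z₂} x≤y₁ x≤y₂ z≤z₁+z₂ = begin
  x * z              ≤⟨ *-monoʳ-≤ x z≤z₁+z₂ ⟩
  x * (z₁ + z₂)      ≡⟨ ℕ.*-distribˡ-+ x z₁ z₂ ⟩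
  x * z₁ + x * z₂    ≤⟨ +-mono-≤ (*-monoˡ-≤ z₁ x≤y₁) (*-monoˡ-≤ z₂ x≤y₂) ⟩
  y₁ * z₁ + y₂ * z₂  ∎
  where open ℕ.≤-Reasoning

m+n≤2*[m⊔n] : ∀ m k → m + k ≤ 2 * (m ⊔ k)
m+n≤2*[m⊔n] m k = subst (m + k ≤_) (sym (cong (λ t → m ⊔ k + t) (ℕ.+-identityʳ (m ⊔ k))))
  (+-mono-≤ (m≤m⊔n m k) (m≤n⊔m m k))

-- a, b are the sizes of the sides of the cut, aₖ, bₖ their traces on Vₖ, iᴬ, iᴮ
-- their traces on I = V₁ ∩ V₂ (of size i), and u = |V₁ ∪ V₂|.
overlap-count : ∀ {a a₁ a₂ b b₁ b₂ i iᴬ iᴮ u} →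
  a ≤ a₁ + a₂ → b ≤ b₁ + b₂ → iᴬ ≤ a₁ → iᴬ ≤ a₂ → iᴮ ≤ b₁ → iᴮ ≤ b₂ →
  i ≤ iᴬ + iᴮ → a ≤ u → b ≤ u →
  i * (a * b) ≤ 4 * u * (a₁ * b₁ ⊔ a₂ * b₂)
overlap-count {a} {a₁} {a₂} {b} {b₁} {b₂} {i} {iᴬ} {iᴮ} {u}
  a≤a₁+a₂ b≤b₁+b₂ iᴬ≤a₁ iᴬ≤a₂ iᴮ≤b₁ iᴮ≤b₂ i≤iᴬ+iᴮ a≤u b≤u = begin
    i * (a * b)                  ≤⟨ *-monoˡ-≤ (a * b) i≤iᴬ+iᴮ ⟩
    (iᴬ + iᴮ) * (a * b)          ≡⟨ regroup iᴬ iᴮ a b ⟩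
    a * (iᴬ * b) + b * (iᴮ * a)  ≤⟨ +-mono-≤ (*-mono-≤ a≤u iᴬb≤S) (*-mono-≤ b≤u iᴮa≤S) ⟩
    u * S + u * S                ≤⟨ +-mono-≤ (*-monoʳ-≤ u S≤2M) (*-monoʳ-≤ u S≤2M) ⟩
    u * (2 * M) + u * (2 * M)    ≡⟨ double u M ⟩
    4 * u * M                    ∎
  where
  open ℕ.≤-Reasoning
  S = a₁ * b₁ + a₂ * b₂
  M = a₁ * b₁ ⊔ a₂ * b₂
  regroup : ∀ x y z w → (x + y) * (z * w) ≡ z * (x * w) + w * (y * z)
  regroup = solve-∀
  double : ∀ x y → x * (2 * y) + x * (2 * y) ≡ 4 * x * y
  double = solve-∀
  iᴬb≤S : iᴬ * b ≤ S
  iᴬb≤S = *-≤-split iᴬ≤a₁ iᴬ≤a₂ b≤b₁+b₂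
  iᴮa≤S : iᴮ * a ≤ S
  iᴮa≤S = subst (iᴮ * a ≤_) (cong₂ _+_ (*-comm b₁ a₁) (*-comm b₂ a₂)) (*-≤-split iᴮ≤b₁ iᴮ≤b₂ a≤a₁+a₂)
  S≤2M : S ≤ 2 * M
  S≤2M = m+n≤2*[m⊔n] (a₁ * b₁) (a₂ * b₂)

overlap-count-cut : (V₁ V₂ : Subset n) {A B : Subset n} → A ∪ B ≡ V₁ ∪ V₂ →
  ∣ V₁ ∩ V₂ ∣ * (∣ A ∣ * ∣ B ∣) ≤
    4 * ∣ V₁ ∪ V₂ ∣ * (∣ A ∩ V₁ ∣ * ∣ B ∩ V₁ ∣ ⊔ ∣ A ∩ V₂ ∣ * ∣ B ∩ V₂ ∣)
overlap-count-cut V₁ V₂ {A} {B} A∪B≡V = overlap-count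
  (∣p∣≤∣p∩q∣+∣p∩r∣ A⊆V) (∣p∣≤∣p∩q∣+∣p∩r∣ B⊆V)
  (∣p∩q∣≤∣p∩r∣ A (p∩q⊆p V₁ V₂)) (∣p∩q∣≤∣p∩r∣ A (p∩q⊆q V₁ V₂))
  (∣p∩q∣≤∣p∩r∣ B (p∩q⊆p V₁ V₂)) (∣p∩q∣≤∣p∩r∣ B (p∩q⊆q V₁ V₂))
  (∣r∣≤∣p∩r∣+∣q∩r∣ (⊆-trans (p∩q⊆p V₁ V₂) (⊆-trans (p⊆p∪q V₂) V⊆A∪B)))
  (p⊆q⇒∣p∣≤∣q∣ A⊆V) (p⊆q⇒∣p∣≤∣q∣ B⊆V)
  where
  V⊆A∪B : V₁ ∪ V₂ ⊆ A ∪ B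
  V⊆A∪B = subst (V₁ ∪ V₂ ⊆_) (sym A∪B≡V) id
  A⊆V : A ⊆ V₁ ∪ V₂
  A⊆V = subst (A ⊆_) A∪B≡V (p⊆p∪q B)
  B⊆V : B ⊆ V₁ ∪ V₂
  B⊆V = subst (B ⊆_) A∪B≡V (q⊆p∪q A B)

cutDense-trace : ∀ q {G F : Graph n} {A B : Subset n} → CutDense q G → G ⊆ᴱ F →
  A ∩ B ≡ ⊥ → V G ⊆ A ∪ B → q ℚ.* ℕ→ℚ (∣ A ∩ V G ∣ * ∣ B ∩ V G ∣) ℚ.≤ ℕ→ℚ (eCount F A B)
cutDense-trace q {G = G} {A = A} {B} dense G⊆F A∩B≡⊥ VG⊆A∪B = ℚ.≤-trans
  (dense (A ∩ V G) (B ∩ V G) (restrict-disjoint (V G) A∩B≡⊥) (restrict-cover VG⊆A∪B))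
  (ℕ→ℚ-mono-≤ (eCount-mono (p∩q⊆p A (V G)) (p∩q⊆p B (V G)) G⊆F))

lemma3p8 : ∀ {n} (q : ℚ) (G₁ G₂ : Graph n) → CutDense q G₁ → CutDense q G₂ →
    .{{_ : NonZero ∣ V G₁ ∪ V G₂ ∣}} →
    CutDense (q ℚ.* quarterRatio ∣ V G₁ ∩ V G₂ ∣ ∣ V G₁ ∪ V G₂ ∣) (G₁ ∪ᴳ G₂)
lemma3p8 q G₁ G₂ dense₁ dense₂ A B A∩B≡⊥ A∪B≡V = ℚ.≤-trans (ℚ.≤-reflexive (*-assoc q r c))
  (*-≤-ℕ→ℚ-weakenʳ q e (ℕ/ℕ*ℕ-nonNeg i (4 * u) (∣ A ∣ * ∣ B ∣) {{m*n≢0 4 u}})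
    (ℕ/ℕ*ℕ≤ℕ i (4 * u) (∣ A ∣ * ∣ B ∣) (m₁ ⊔ m₂) {{m*n≢0 4 u}} (overlap-count-cut V₁ V₂ A∪B≡V))
    (*-ℕ→ℚ-⊔-≤ q m₁ m₂ e
      (cutDense-trace q dense₁ (⊆ᴱ-∪ᴳˡ G₁ G₂) A∩B≡⊥ (⊆-trans (p⊆p∪q V₂) V⊆A∪B))
      (cutDense-trace q dense₂ (⊆ᴱ-∪ᴳʳ G₁ G₂) A∩B≡⊥ (⊆-trans (q⊆p∪q V₁ V₂) V⊆A∪B))))
  where
  V₁ = V G₁
  V₂ = V G₂
  u = ∣ V₁ ∪ V₂ ∣
  i = ∣ V₁ ∩ V₂ ∣
  r = quarterRatio i u
  c = ℕ→ℚ (∣ A ∣ * ∣ B ∣)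
  e = eCount (G₁ ∪ᴳ G₂) A B
  m₁ = ∣ A ∩ V₁ ∣ * ∣ B ∩ V₁ ∣
  m₂ = ∣ A ∩ V₂ ∣ * ∣ B ∩ V₂ ∣
  V⊆A∪B : V₁ ∪ V₂ ⊆ A ∪ B
  V⊆A∪B = subst (V₁ ∪ V₂ ⊆_) (sym A∪B≡V) id
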